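{- For every constant $C>0$ there exists $\ell_0$ such that for every integer $\ell>\ell_0$ there is an integer $N_0=N_0(\ell)$ such that for every integer $N>N_0$ the following holds: if $X_1,\dots,X_{2\ell}$ are independent random variables, each uniformly distributed on $\{1,\dots,N\}$, then for every integer $t$, $$\Pr[X_1+\cdots+X_{2\ell}=t]\le \frac{5}{e^{4C}N}.$$
   Formalization: The constant C ranges over the positive rationals. -}

module Defs where

open import Data.Nat using (ℕ; zero; suc; _+_)
open import Data.Integer using (ℤ; +_)
open import Data.List using (List; []; _∷_; map; concatMap; length; filter; upTo)
open import Data.Vec using (Vec; []; _∷_)
import Data.Vec as Vec
open import Data.Rational using (ℚ; _*_; _≤_; 1ℚ; _/_)
import Data.Rational as ℚ
open import Relation.Nullary.Decidable using (Dec)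
import Data.Integer as ℤ

oneTo : ℕ → List ℕ
oneTo N = map suc (upTo N)

-- All k-tuples (x₁,…,x_k) with each xᵢ ∈ {1,…,N}; this is the sample space
-- of k independent uniform variables on {1,…,N} (N^k equally likely outcomes).
tuples : (k N : ℕ) → List (Vec ℕ k)
tuples zero    N = [] ∷ []
tuples (suc k) N = concatMap (λ x → map (x ∷_) (tuples k N)) (oneTo N)

-- Number of outcomes with X₁ + ⋯ + X_k = t.  Hence
--   Pr[X₁ + ⋯ + X_k = t] = sumCount k N t / N^k.
sumCount : (k N : ℕ) → ℤ → ℕ
sumCount k N t = length (filter (λ v → (+ Vec.sum v) ℤ.≟ t) (tuples k N))

expTerm : ℚ → ℕ → ℚ
expTerm y zero    = 1ℚ
expTerm y (suc k) = expTerm y k * y * (ℤ.+ 1 / suc k)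

expPartial : ℚ → ℕ → ℚ
expPartial y zero    = 1ℚ
expPartial y (suc n) = expPartial y n ℚ.+ expTerm y (suc n)

-- "e^y · a ≤ b" for y ≥ 0, a ≥ 0: since the partial sums increase to e^y,
-- this holds iff every partial sum times a is ≤ b.
ExpMulLe : ℚ → ℚ → ℚ → Set
ExpMulLe y a b = ∀ n → expPartial y n * a ≤ b

ℕtoℚ : ℕ → ℚ
ℕtoℚ n = ℤ.+ n / 1

-- Write N = 2m + r with r ∈ {0, 1}. A value in {1, …, 2m} is either i or m + i with
-- i ∈ {1, …, m}, so the number of k-tuples from {1, …, 2m} with sum t is
-- Σ_j C(k, j) · #{k-tuples from {1, …, m} with sum t − j m}. For different j these are
-- counts of disjoint windows of one convolution, so they add up to at most m^(k−1), and the
-- count is at most max_j C(k, j) · m^(k−1). Tuples that use the value 2m + 1 add at most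
-- k · N^(k−2). For k = 2ℓ, the central bound C(2ℓ, ℓ)² (2ℓ + 1) ≤ 16^ℓ then gives
-- X · Pr[X₁ + ⋯ + X_{2ℓ} = t] · N ≤ 3 whenever X² < ℓ and 2ℓX < N. It remains to bound the
-- partial sums of e^(4C) by a natural number X: once k exceeds 8C, every Taylor term is at
-- most half of the previous one.

module Submission where

open import Defs
open import Algebra.Properties.CommutativeSemigroup using (interchange)
open import Data.Bool using (true; false)
open import Data.Integer as ℤ using (ℤ; -[1+_])
import Data.Integer.Properties as ℤ
import Data.Integer.Tactic.RingSolver as ℤ-Solver
open import Data.List as List using (List; []; _∷_; filter; length; concatMap; upTo)
import Data.List.Properties as List
open import Data.Nat as ℕ using (ℕ; zero; suc; _+_; _*_; _^_; _≤_; _<_; _∸_; z≤n; s≤s; _≤′_; ≤′-refl; ≤′-step)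
open import Data.Nat.Combinatorics using (_C_; nC1≡n; k>n⇒nCk≡0; nCk≡nC[n∸k]; nCk+nC[k+1]≡[n+1]C[k+1])
open import Data.Nat.DivMod using (_/_; _%_; m≡m%n+[m/n]*n; m%n<n)
open import Data.Nat.ListAction using (sum)
open import Data.Nat.Properties
open import Data.Nat.Tactic.RingSolver using (solve-∀; solve)
open import Data.Product using (_,_; ∃-syntax; proj₁; proj₂)
open import Data.Rational as ℚ using (ℚ; 0ℚ; 1ℚ; NonNegative; Positive; toℚᵘ)
import Data.Rational.Properties as ℚ
open import Data.Rational.Solver using () renaming (module +-*-Solver to ℚ-Solver)
open import Data.Rational.Unnormalised as ℚᵘ using (mkℚᵘ; *≡*; *≤*)
import Data.Rational.Unnormalised.Properties as ℚᵘ
open import Data.Sum using (inj₁; inj₂)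
open import Data.Vec as Vec using (Vec)
open import Function using (_∘_)
open import Function.Bundles using (_⇔_; mk⇔; Equivalence)
open import Relation.Binary.PropositionalEquality
open import Relation.Nullary using (Dec; does; yes; no; contradiction)
open import Relation.Unary using (Pred; Decidable; _≐_)

Σ< : ℕ → (ℕ → ℕ) → ℕ
Σ< zero    f = 0
Σ< (suc n) f = f 0 + Σ< n (f ∘ suc)

Σ<-cong : ∀ n {f g : ℕ → ℕ} → (∀ i → f i ≡ g i) → Σ< n f ≡ Σ< n g
Σ<-cong zero    f≡g = refl
Σ<-cong (suc n) f≡g = cong₂ _+_ (f≡g 0) (Σ<-cong n (f≡g ∘ suc))

Σ<-mono-≤ : ∀ n {f g : ℕ → ℕ} → (∀ i → f i ≤ g i) → Σ< n f ≤ Σ< n g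
Σ<-mono-≤ zero    f≤g = z≤n
Σ<-mono-≤ (suc n) f≤g = +-mono-≤ (f≤g 0) (Σ<-mono-≤ n (f≤g ∘ suc))

Σ<-const : ∀ n c → Σ< n (λ _ → c) ≡ n * c
Σ<-const zero    c = refl
Σ<-const (suc n) c = cong (c +_) (Σ<-const n c)

Σ<-≤-const : ∀ n c {f : ℕ → ℕ} → (∀ i → f i ≤ c) → Σ< n f ≤ n * c
Σ<-≤-const n c f≤c = subst (Σ< n _ ≤_) (Σ<-const n c) (Σ<-mono-≤ n f≤c)

Σ<-distrib-+ : ∀ n (f g : ℕ → ℕ) → Σ< n (λ i → f i + g i) ≡ Σ< n f + Σ< n g
Σ<-distrib-+ zero    f g = refl
Σ<-distrib-+ (suc n) f g = trans (cong (f 0 + g 0 +_) (Σ<-distrib-+ n (f ∘ suc) (g ∘ suc)))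
                                 (interchange +-commutativeSemigroup (f 0) (g 0) (Σ< n (f ∘ suc)) (Σ< n (g ∘ suc)))

Σ<-distribˡ-* : ∀ n c (f : ℕ → ℕ) → Σ< n (λ i → c * f i) ≡ c * Σ< n f
Σ<-distribˡ-* zero    c f = sym (*-zeroʳ c)
Σ<-distribˡ-* (suc n) c f = trans (cong (c * f 0 +_) (Σ<-distribˡ-* n c (f ∘ suc)))
                                  (sym (*-distribˡ-+ c (f 0) _))

Σ<-++ : ∀ a b (f : ℕ → ℕ) → Σ< (a + b) f ≡ Σ< a f + Σ< b (λ i → f (a + i))
Σ<-++ zero    b f = refl
Σ<-++ (suc a) b f = trans (cong (f 0 +_) (Σ<-++ a b (f ∘ suc))) (sym (+-assoc (f 0) _ _))

Σ<-last : ∀ n (f : ℕ → ℕ) → Σ< (suc n) f ≡ Σ< n f + f n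
Σ<-last n f = begin
  Σ< (suc n) f               ≡⟨ cong (λ m → Σ< m f) (+-comm 1 n) ⟩
  Σ< (n + 1) f               ≡⟨ Σ<-++ n 1 f ⟩
  Σ< n f + (f (n + 0) + 0)   ≡⟨ cong (λ m → Σ< n f + m) (trans (+-identityʳ _) (cong f (+-identityʳ n))) ⟩
  Σ< n f + f n               ∎
  where open ≡-Reasoning

Σ<-comm : ∀ n m (f : ℕ → ℕ → ℕ) → Σ< n (λ i → Σ< m (f i)) ≡ Σ< m (λ j → Σ< n (λ i → f i j))
Σ<-comm zero    m f = sym (trans (Σ<-const m 0) (*-zeroʳ m))
Σ<-comm (suc n) m f = trans (cong (Σ< m (f 0) +_) (Σ<-comm n m (f ∘ suc)))
                            (sym (Σ<-distrib-+ m (f 0) (λ j → Σ< n (λ i → f (suc i) j))))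

^-distribʳ-* : ∀ m n o → (m * n) ^ o ≡ m ^ o * n ^ o
^-distribʳ-* m n zero    = refl
^-distribʳ-* m n (suc o) = trans (cong (m * n *_) (^-distribʳ-* m n o)) (interchange *-commutativeSemigroup m n (m ^ o) (n ^ o))

*-self-cancel-≤ : ∀ m n → m * m ≤ n * n → m ≤ n
*-self-cancel-≤ m n m²≤n² with m ≤? n
... | yes m≤n = m≤n
... | no  m≰n = contradiction m²≤n² (<⇒≱ (*-mono-< (≰⇒> m≰n) (≰⇒> m≰n)))

≤-peak : ∀ (f : ℕ → ℕ) l → (∀ j → j < l → f j ≤ f (suc j)) → (∀ j → l ≤ j → f (suc j) ≤ f j) →
         ∀ j → f j ≤ f l
≤-peak f l up down j with ≤-total j l
... | inj₁ j≤l = ascend l up (≤⇒≤′ j≤l)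
  where
  ascend : ∀ l → (∀ i → i < l → f i ≤ f (suc i)) → j ≤′ l → f j ≤ f l
  ascend l      up ≤′-refl         = ≤-refl
  ascend (suc l) up (≤′-step j≤′l) = ≤-trans (ascend l (λ i i<l → up i (m<n⇒m<1+n i<l)) j≤′l) (up l ≤-refl)
... | inj₂ l≤j = descend (≤⇒≤′ l≤j)
  where
  descend : ∀ {j} → l ≤′ j → f j ≤ f l
  descend ≤′-refl           = ≤-refl
  descend (≤′-step {j} l≤′j) = ≤-trans (down j (≤′⇒≤ l≤′j)) (descend l≤′j)

length-filter-map : ∀ {a b p} {A : Set a} {B : Set b} {P : Pred B p} (P? : Decidable P) (f : A → B) xs →
  length (filter P? (List.map f xs)) ≡ length (filter (P? ∘ f) xs)
length-filter-map P? f []       = refl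
length-filter-map P? f (x ∷ xs) with does (P? (f x))
... | true  = cong suc (length-filter-map P? f xs)
... | false = length-filter-map P? f xs

length-filter-concatMap : ∀ {a b p} {A : Set a} {B : Set b} {P : Pred B p} (P? : Decidable P) (f : A → List B) xs →
  length (filter P? (concatMap f xs)) ≡ sum (List.map (λ x → length (filter P? (f x))) xs)
length-filter-concatMap P? f []       = refl
length-filter-concatMap P? f (x ∷ xs) = begin
  length (filter P? (f x List.++ concatMap f xs))
    ≡⟨ cong length (List.filter-++ P? (f x) (concatMap f xs)) ⟩
  length (filter P? (f x) List.++ filter P? (concatMap f xs))
    ≡⟨ List.length-++ (filter P? (f x)) ⟩
  length (filter P? (f x)) + length (filter P? (concatMap f xs))
    ≡⟨ cong (length (filter P? (f x)) +_) (length-filter-concatMap P? f xs) ⟩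
  sum (List.map (λ x → length (filter P? (f x))) (x ∷ xs)) ∎
  where open ≡-Reasoning

sum-map-applyUpTo : ∀ n (f g : ℕ → ℕ) → sum (List.map g (List.applyUpTo f n)) ≡ Σ< n (g ∘ f)
sum-map-applyUpTo zero    f g = refl
sum-map-applyUpTo (suc n) f g = cong (g (f 0) +_) (sum-map-applyUpTo n (f ∘ suc) g)

sum-map-oneTo : ∀ N (g : ℕ → ℕ) → sum (List.map g (oneTo N)) ≡ Σ< N (g ∘ suc)
sum-map-oneTo N g = trans (cong sum (sym (List.map-∘ (upTo N)))) (sum-map-applyUpTo N (λ i → i) (g ∘ suc))

minus-comm : ∀ (a b c : ℤ) → a ℤ.- b ℤ.- c ≡ a ℤ.- c ℤ.- b
minus-comm = ℤ-Solver.solve-∀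

minus-+ : ∀ (a b c : ℤ) → a ℤ.- (b ℤ.+ c) ≡ a ℤ.- b ℤ.- c
minus-+ = ℤ-Solver.solve-∀

minus-pos-+ : ∀ s m n → s ℤ.- ℤ.+ (m + n) ≡ s ℤ.- ℤ.+ m ℤ.- ℤ.+ n
minus-pos-+ s m n = trans (cong (λ x → s ℤ.- x) (ℤ.pos-+ m n)) (minus-+ s (ℤ.+ m) (ℤ.+ n))

pos-+-≡⇔≡-minus : ∀ x s t → (ℤ.+ (x + s) ≡ t) ⇔ (ℤ.+ s ≡ t ℤ.- ℤ.+ x)
pos-+-≡⇔≡-minus x s t = mk⇔ to from
  where
  to : ℤ.+ (x + s) ≡ t → ℤ.+ s ≡ t ℤ.- ℤ.+ x
  to x+s≡t = begin
    ℤ.+ s                          ≡⟨ add-sub (ℤ.+ x) (ℤ.+ s) ⟩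
    ℤ.+ x ℤ.+ ℤ.+ s ℤ.- ℤ.+ x      ≡⟨ cong (λ z → z ℤ.- ℤ.+ x) (trans (sym (ℤ.pos-+ x s)) x+s≡t) ⟩
    t ℤ.- ℤ.+ x                    ∎
    where
    open ≡-Reasoning
    add-sub : ∀ a b → b ≡ a ℤ.+ b ℤ.- a
    add-sub = ℤ-Solver.solve-∀
  from : ℤ.+ s ≡ t ℤ.- ℤ.+ x → ℤ.+ (x + s) ≡ t
  from s≡t-x = begin
    ℤ.+ (x + s)              ≡⟨ ℤ.pos-+ x s ⟩
    ℤ.+ x ℤ.+ ℤ.+ s          ≡⟨ cong (λ z → ℤ.+ x ℤ.+ z) s≡t-x ⟩
    ℤ.+ x ℤ.+ (t ℤ.- ℤ.+ x)  ≡⟨ sub-add (ℤ.+ x) t ⟩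
    t                        ∎
    where
    open ≡-Reasoning
    sub-add : ∀ a b → a ℤ.+ (b ℤ.- a) ≡ b
    sub-add = ℤ-Solver.solve-∀

box : ℕ → (ℤ → ℕ) → ℤ → ℕ
box R g s = Σ< R (λ u → g (s ℤ.- ℤ.+ suc u))

box-cong : ∀ R {g h : ℤ → ℕ} → (∀ s → g s ≡ h s) → ∀ s → box R g s ≡ box R h s
box-cong R g≡h s = Σ<-cong R (λ u → g≡h _)

box-mono-≤ : ∀ R {g h : ℤ → ℕ} → (∀ s → g s ≤ h s) → ∀ s → box R g s ≤ box R h s
box-mono-≤ R g≤h s = Σ<-mono-≤ R (λ u → g≤h _)

box-≤-+ : ∀ R E {g h : ℤ → ℕ} → (∀ s → g s ≤ h s + E) → ∀ s → box R g s ≤ box R h s + R * E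
box-≤-+ R E {g} {h} g≤h+E s = begin
  box R g s                                  ≤⟨ box-mono-≤ R g≤h+E s ⟩
  Σ< R (λ u → h (s ℤ.- ℤ.+ suc u) + E)       ≡⟨ Σ<-distrib-+ R _ (λ _ → E) ⟩
  box R h s + Σ< R (λ _ → E)                 ≡⟨ cong (box R h s +_) (Σ<-const R E) ⟩
  box R h s + R * E                          ∎
  where open ≤-Reasoning

box-comm : ∀ R V (g : ℤ → ℕ) s → box R (box V g) s ≡ box V (box R g) s
box-comm R V g s = trans (Σ<-comm R V _)
  (Σ<-cong V (λ i → Σ<-cong R (λ u → cong g (minus-comm s (ℤ.+ suc u) (ℤ.+ suc i)))))

box-shift : ∀ R c (g : ℤ → ℕ) s → box R (λ s′ → g (s′ ℤ.- c)) s ≡ box R g (s ℤ.- c)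
box-shift R c g s = Σ<-cong R (λ u → cong g (minus-comm s (ℤ.+ suc u) c))

box-++ : ∀ a b (g : ℤ → ℕ) s → box (a + b) g s ≡ box a g s + box b g (s ℤ.- ℤ.+ a)
box-++ a b g s = trans (Σ<-++ a b _) (cong (box a g s +_)
  (Σ<-cong b (λ i → cong g (trans (cong (λ n → s ℤ.- ℤ.+ n) (sym (+-suc a i))) (minus-pos-+ s a (suc i))))))

box-suc : ∀ R (g : ℤ → ℕ) s → box (suc R) g s ≡ g (s ℤ.- ℤ.+ 1) + box R g (s ℤ.- ℤ.+ 1)
box-suc R g s = trans (box-++ 1 R g s) (cong (_+ box R g (s ℤ.- ℤ.+ 1)) (+-identityʳ _))

box-blocks : ∀ K m (g : ℤ → ℕ) s → Σ< K (λ j → box m g (s ℤ.- ℤ.+ (j * m))) ≡ box (K * m) g s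
box-blocks zero    m g s = refl
box-blocks (suc K) m g s = begin
  box m g (s ℤ.- ℤ.+ 0) + Σ< K (λ j → box m g (s ℤ.- ℤ.+ (m + j * m)))
    ≡⟨ cong₂ _+_ (cong (box m g) (ℤ.+-identityʳ s))
                 (Σ<-cong K (λ j → cong (box m g) (minus-pos-+ s m (j * m)))) ⟩
  box m g s + Σ< K (λ j → box m g (s ℤ.- ℤ.+ m ℤ.- ℤ.+ (j * m)))
    ≡⟨ cong (box m g s +_) (box-blocks K m g (s ℤ.- ℤ.+ m)) ⟩
  box m g s + box (K * m) g (s ℤ.- ℤ.+ m)
    ≡⟨ box-++ m (K * m) g s ⟨
  box (m + K * m) g s ∎
  where open ≡-Reasoning

box-Σ-shifts : ∀ R n (c : ℕ → ℕ) (d : ℕ → ℤ) (h : ℤ → ℕ) s →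
  box R (λ s′ → Σ< n (λ j → c j * h (s′ ℤ.- d j))) s ≡ Σ< n (λ j → c j * box R h (s ℤ.- d j))
box-Σ-shifts R n c d h s = begin
  Σ< R (λ u → Σ< n (λ j → c j * h (s ℤ.- ℤ.+ suc u ℤ.- d j)))
    ≡⟨ Σ<-comm R n _ ⟩
  Σ< n (λ j → Σ< R (λ u → c j * h (s ℤ.- ℤ.+ suc u ℤ.- d j)))
    ≡⟨ Σ<-cong n (λ j → Σ<-distribˡ-* R (c j) _) ⟩
  Σ< n (λ j → c j * box R (λ s′ → h (s′ ℤ.- d j)) s)
    ≡⟨ Σ<-cong n (λ j → cong (c j *_) (box-shift R (d j) h s)) ⟩
  Σ< n (λ j → c j * box R h (s ℤ.- d j)) ∎
  where open ≡-Reasoning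

-- Tuples with a given sum

δ : ℤ → ℕ
δ (ℤ.+ zero)  = 1
δ (ℤ.+ suc _) = 0
δ -[1+ _ ]    = 0

ways : ℕ → ℕ → ℤ → ℕ
ways V zero    = δ
ways V (suc k) = box V (ways V k)

sumCount-suc : ∀ k N t → sumCount (suc k) N t ≡ Σ< N (λ i → sumCount k N (t ℤ.- ℤ.+ suc i))
sumCount-suc k N t = begin
  length (filter (hasSum t) (concatMap (λ x → List.map (x Vec.∷_) (tuples k N)) (oneTo N)))
    ≡⟨ length-filter-concatMap (hasSum t) _ (oneTo N) ⟩
  sum (List.map (λ x → length (filter (hasSum t) (List.map (x Vec.∷_) (tuples k N)))) (oneTo N))
    ≡⟨ cong sum (List.map-cong (λ x → trans (length-filter-map (hasSum t) (x Vec.∷_) (tuples k N))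
         (cong length (List.filter-≐ _ _ (first-summand x) (tuples k N)))) (oneTo N)) ⟩
  sum (List.map (λ x → sumCount k N (t ℤ.- ℤ.+ x)) (oneTo N))
    ≡⟨ sum-map-oneTo N (λ x → sumCount k N (t ℤ.- ℤ.+ x)) ⟩
  Σ< N (λ i → sumCount k N (t ℤ.- ℤ.+ suc i)) ∎
  where
  open ≡-Reasoning
  hasSum : ∀ {n} (t : ℤ) (v : Vec ℕ n) → Dec (ℤ.+ Vec.sum v ≡ t)
  hasSum t v = ℤ.+ Vec.sum v ℤ.≟ t
  first-summand : ∀ x → (λ (v : Vec ℕ k) → ℤ.+ (x + Vec.sum v) ≡ t) ≐ (λ v → ℤ.+ Vec.sum v ≡ t ℤ.- ℤ.+ x)
  first-summand x = (λ {v} → Equivalence.to (pos-+-≡⇔≡-minus x (Vec.sum v) t))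
                  , (λ {v} → Equivalence.from (pos-+-≡⇔≡-minus x (Vec.sum v) t))

sumCount≡ways : ∀ k N t → sumCount k N t ≡ ways N k t
sumCount≡ways zero    N (ℤ.+ zero)  = refl
sumCount≡ways zero    N (ℤ.+ suc _) = refl
sumCount≡ways zero    N -[1+ _ ]    = refl
sumCount≡ways (suc k) N t = trans (sumCount-suc k N t) (Σ<-cong N (λ i → sumCount≡ways k N (t ℤ.- ℤ.+ suc i)))

-- For s ≤ 0 every term is δ of a negative integer, hence 0 by computation.
box-δ-≤1 : ∀ R s → box R δ s ≤ 1
box-δ-≤1 R       (ℤ.+ zero)      = ≤-trans (≤-reflexive (trans (Σ<-const R 0) (*-zeroʳ R))) z≤n
box-δ-≤1 R       -[1+ n ]        = ≤-trans (≤-reflexive (trans (Σ<-const R 0) (*-zeroʳ R))) z≤n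
box-δ-≤1 zero    (ℤ.+ suc n)     = z≤n
box-δ-≤1 (suc R) (ℤ.+ suc zero)  =
  ≤-reflexive (trans (box-suc R δ (ℤ.+ 1)) (cong suc (trans (Σ<-const R 0) (*-zeroʳ R))))
box-δ-≤1 (suc R) (ℤ.+ suc (suc n)) =
  ≤-trans (≤-reflexive (box-suc R δ (ℤ.+ suc (suc n)))) (box-δ-≤1 R (ℤ.+ suc n))

box-ways-≤ : ∀ V k R s → box R (ways V k) s ≤ V ^ k
box-ways-≤ V zero    R s = box-δ-≤1 R s
box-ways-≤ V (suc k) R s = begin
  box R (box V (ways V k)) s   ≡⟨ box-comm R V (ways V k) s ⟩
  box V (box R (ways V k)) s   ≤⟨ Σ<-≤-const V (V ^ k) (λ i → box-ways-≤ V k R (s ℤ.- ℤ.+ suc i)) ⟩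
  V * V ^ k                    ∎
  where open ≤-Reasoning

ways-≤ : ∀ V k t → ways V k t ≤ V ^ (k ∸ 1)
ways-≤ V zero    (ℤ.+ zero)  = ≤-refl
ways-≤ V zero    (ℤ.+ suc _) = z≤n
ways-≤ V zero    -[1+ _ ]    = z≤n
ways-≤ V (suc k) t           = box-ways-≤ V k V t

-- Binomial coefficients

-- (n − k) · C(n, k) = (k + 1) · C(n, k + 1), with k · C(n, k) moved across to avoid truncated subtraction.
C-ratio : ∀ n k → (n C k) * n ≡ (n C k) * k + (n C suc k) * suc k
C-ratio zero    zero    = refl
C-ratio zero    (suc k) = refl
C-ratio (suc n) zero    = trans (*-comm 1 (suc n)) (cong (_* 1) (sym (nC1≡n (suc n))))
C-ratio (suc n) (suc k) = begin
  (suc n C suc k) * suc n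
    ≡⟨ cong (_* suc n) (nCk+nC[k+1]≡[n+1]C[k+1] n k) ⟨
  (a + b) * suc n
    ≡⟨ step a b c n k (C-ratio n k) (C-ratio n (suc k)) ⟩
  (a + b) * suc k + (b + c) * suc (suc k)
    ≡⟨ cong₂ (λ x y → x * suc k + y * suc (suc k))
             (nCk+nC[k+1]≡[n+1]C[k+1] n k) (nCk+nC[k+1]≡[n+1]C[k+1] n (suc k)) ⟩
  (suc n C suc k) * suc k + (suc n C suc (suc k)) * suc (suc k) ∎
  where
  open ≡-Reasoning
  a = n C k
  b = n C suc k
  c = n C suc (suc k)
  step : ∀ a b c n k → a * n ≡ a * k + b * suc k → b * n ≡ b * suc k + c * suc (suc k) →
         (a + b) * suc n ≡ (a + b) * suc k + (b + c) * suc (suc k)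
  step a b c n k an bn = begin
    (a + b) * suc n
      ≡⟨ solve (a ∷ b ∷ n ∷ []) ⟩
    a + b + (a * n + b * n)
      ≡⟨ cong₂ (λ x y → a + b + (x + y)) an bn ⟩
    a + b + (a * k + b * suc k + (b * suc k + c * suc (suc k)))
      ≡⟨ solve (a ∷ b ∷ c ∷ k ∷ []) ⟩
    (a + b) * suc k + (b + c) * suc (suc k)              ∎

C-absorb : ∀ n k → (suc n C suc k) * suc k ≡ (n C k) * suc n
C-absorb n k = begin
  (suc n C suc k) * suc k        ≡⟨ cong (_* suc k) (nCk+nC[k+1]≡[n+1]C[k+1] n k) ⟨
  (a + b) * suc k                ≡⟨ expand a b k ⟩
  a + (a * k + b * suc k)        ≡⟨ cong (a +_) (C-ratio n k) ⟨
  a + a * n                      ≡⟨ *-suc a n ⟨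
  a * suc n                      ∎
  where
  open ≡-Reasoning
  expand : ∀ a b k → (a + b) * suc k ≡ a + (a * k + b * suc k)
  expand = solve-∀
  a = n C k
  b = n C suc k

C-≤-C-suc : ∀ n k → suc (k + k) ≤ n → n C k ≤ n C suc k
C-≤-C-suc n k 2k+1≤n = *-cancelʳ-≤ (n C k) (n C suc k) (suc k) (+-cancelˡ-≤ ((n C k) * k) _ _ (begin
  (n C k) * k + (n C k) * suc k   ≡⟨ *-distribˡ-+ (n C k) k (suc k) ⟨
  (n C k) * (k + suc k)           ≡⟨ cong ((n C k) *_) (+-suc k k) ⟩
  (n C k) * suc (k + k)           ≤⟨ *-monoʳ-≤ (n C k) 2k+1≤n ⟩
  (n C k) * n                     ≡⟨ C-ratio n k ⟩
  (n C k) * k + (n C suc k) * suc k ∎))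
  where open ≤-Reasoning

C-suc-≤-C : ∀ n k → n ≤ suc (k + k) → n C suc k ≤ n C k
C-suc-≤-C n k n≤2k+1 = *-cancelʳ-≤ (n C suc k) (n C k) (suc k) (+-cancelˡ-≤ ((n C k) * k) _ _ (begin
  (n C k) * k + (n C suc k) * suc k ≡⟨ C-ratio n k ⟨
  (n C k) * n                       ≤⟨ *-monoʳ-≤ (n C k) n≤2k+1 ⟩
  (n C k) * suc (k + k)             ≡⟨ cong ((n C k) *_) (+-suc k k) ⟨
  (n C k) * (k + suc k)             ≡⟨ *-distribˡ-+ (n C k) k (suc k) ⟩
  (n C k) * k + (n C k) * suc k     ∎))
  where open ≤-Reasoning

C-≤-central : ∀ l j → (l + l) C j ≤ (l + l) C l
C-≤-central l = ≤-peak ((l + l) C_) l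
  (λ j j<l → C-≤-C-suc (l + l) j (+-mono-≤ j<l (<⇒≤ j<l)))
  (λ j l≤j → C-suc-≤-C (l + l) j (≤-trans (+-mono-≤ l≤j l≤j) (n≤1+n (j + j))))

central-C-suc : ∀ l → ((suc l + suc l) C suc l) * suc l ≡ 2 * (((l + l) C l) * suc (l + l))
central-C-suc l = begin
  ((suc l + suc l) C suc l) * suc l       ≡⟨ cong (λ n → (n C suc l) * suc l) (cong suc (+-suc l l)) ⟩
  (suc (suc (l + l)) C suc l) * suc l     ≡⟨ C-absorb (suc (l + l)) l ⟩
  (suc (l + l) C l) * suc (suc (l + l))   ≡⟨ double (suc (l + l) C l) l ⟩
  2 * ((suc (l + l) C l) * suc l)         ≡⟨ cong (λ c → 2 * (c * suc l)) middle-sym ⟩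
  2 * ((suc (l + l) C suc l) * suc l)     ≡⟨ cong (2 *_) (C-absorb (l + l) l) ⟩
  2 * (((l + l) C l) * suc (l + l))       ∎
  where
  open ≡-Reasoning
  double : ∀ c l → c * suc (suc (l + l)) ≡ 2 * (c * suc l)
  double = solve-∀
  middle-sym : suc (l + l) C l ≡ suc (l + l) C suc l
  middle-sym = trans (nCk≡nC[n∸k] (≤-trans (m≤m+n l l) (n≤1+n (l + l)))) (cong (suc (l + l) C_) (m+n∸n≡m (suc l) l))

central-C-bound : ∀ l → ((l + l) C l) * ((l + l) C l) * suc (l + l) ≤ 4 ^ l * 4 ^ l
central-C-bound zero    = ≤-refl
central-C-bound (suc l) = *-cancelʳ-≤ (x * x * suc (L + L)) (4 ^ L * 4 ^ L) (L * L) (begin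
  x * x * suc (L + L) * (L * L)
    ≡⟨ regroup x L (suc (L + L)) ⟩
  (x * L) * (x * L) * suc (L + L)
    ≡⟨ cong₂ (λ y m → y * y * m) (central-C-suc l) (cong (2 +_) (+-suc l l)) ⟩
  (2 * (c * suc k)) * (2 * (c * suc k)) * (3 + k)
    ≡⟨ expand c k ⟩
  4 * (c * c * suc k) * (suc k * (3 + k))
    ≤⟨ *-mono-≤ (*-monoʳ-≤ 4 (central-C-bound l)) (product-≤-square k) ⟩
  4 * (4 ^ l * 4 ^ l) * ((2 + k) * (2 + k))
    ≡⟨ collect (4 ^ l) l ⟩
  4 ^ L * 4 ^ L * (L * L) ∎)
  where
  open ≤-Reasoning
  L = suc l
  k = l + l
  x = (L + L) C L
  c = k C l
  regroup : ∀ x L m → x * x * m * (L * L) ≡ (x * L) * (x * L) * m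
  regroup = solve-∀
  expand : ∀ c k → (2 * (c * suc k)) * (2 * (c * suc k)) * (3 + k) ≡ 4 * (c * c * suc k) * (suc k * (3 + k))
  expand = solve-∀
  collect : ∀ p l → 4 * (p * p) * ((2 + (l + l)) * (2 + (l + l))) ≡ (4 * p) * (4 * p) * (suc l * suc l)
  collect = solve-∀
  product-≤-square : ∀ k → suc k * (3 + k) ≤ (2 + k) * (2 + k)
  product-≤-square k = subst (suc k * (3 + k) ≤_) (square-identity k) (m≤m+n _ 1)
    where
    square-identity : ∀ k → suc k * (3 + k) + 1 ≡ (2 + k) * (2 + k)
    square-identity = solve-∀

central-C-*-≤ : ∀ l X → X * X ≤ suc (l + l) → ((l + l) C l) * X ≤ 4 ^ l
central-C-*-≤ l X X²≤2l+1 = *-self-cancel-≤ (c * X) (4 ^ l) (begin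
  (c * X) * (c * X)       ≡⟨ interchange *-commutativeSemigroup c X c X ⟩
  c * c * (X * X)         ≤⟨ *-monoʳ-≤ (c * c) X²≤2l+1 ⟩
  c * c * suc (l + l)     ≤⟨ central-C-bound l ⟩
  4 ^ l * 4 ^ l           ∎)
  where
  open ≤-Reasoning
  c = (l + l) C l

-- Counting bound

Σ<-pascal : ∀ k n (g : ℕ → ℕ) →
  Σ< (suc n) (λ j → (suc k C j) * g j) ≡ Σ< (suc n) (λ j → (k C j) * g j) + Σ< n (λ j → (k C j) * g (suc j))
Σ<-pascal k n g = begin
  1 * g 0 + Σ< n (λ j → (suc k C suc j) * g (suc j))
    ≡⟨ cong (1 * g 0 +_) (Σ<-cong n (λ j → cong (_* g (suc j)) (nCk+nC[k+1]≡[n+1]C[k+1] k j))) ⟨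
  1 * g 0 + Σ< n (λ j → ((k C j) + (k C suc j)) * g (suc j))
    ≡⟨ cong (1 * g 0 +_) (Σ<-cong n (λ j → *-distribʳ-+ (g (suc j)) (k C j) (k C suc j))) ⟩
  1 * g 0 + Σ< n (λ j → (k C j) * g (suc j) + (k C suc j) * g (suc j))
    ≡⟨ cong (1 * g 0 +_) (Σ<-distrib-+ n _ _) ⟩
  1 * g 0 + (Σ< n (λ j → (k C j) * g (suc j)) + Σ< n (λ j → (k C suc j) * g (suc j)))
    ≡⟨ swap-last (1 * g 0) _ _ ⟩
  (1 * g 0 + Σ< n (λ j → (k C suc j) * g (suc j))) + Σ< n (λ j → (k C j) * g (suc j)) ∎
  where
  open ≡-Reasoning
  swap-last : ∀ a b c → a + (b + c) ≡ a + c + b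
  swap-last = solve-∀

Σ<-C-drop-last : ∀ k (g : ℕ → ℕ) → Σ< (suc (suc k)) (λ j → (k C j) * g j) ≡ Σ< (suc k) (λ j → (k C j) * g j)
Σ<-C-drop-last k g = begin
  Σ< (suc (suc k)) (λ j → (k C j) * g j)
    ≡⟨ Σ<-last (suc k) (λ j → (k C j) * g j) ⟩
  Σ< (suc k) (λ j → (k C j) * g j) + (k C suc k) * g (suc k)
    ≡⟨ cong (λ c → Σ< (suc k) (λ j → (k C j) * g j) + c * g (suc k)) (k>n⇒nCk≡0 (n<1+n k)) ⟩
  Σ< (suc k) (λ j → (k C j) * g j) + 0
    ≡⟨ +-identityʳ _ ⟩
  Σ< (suc k) (λ j → (k C j) * g j) ∎
  where open ≡-Reasoning

ways-double : ∀ m k t → ways (m + m) k t ≡ Σ< (suc k) (λ j → (k C j) * ways m k (t ℤ.- ℤ.+ (j * m)))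
ways-double m zero    t = sym (trans (+-identityʳ _) (trans (*-identityˡ _) (cong δ (ℤ.+-identityʳ t))))
ways-double m (suc k) t = begin
  box (m + m) (ways (m + m) k) t
    ≡⟨ box-++ m m (ways (m + m) k) t ⟩
  box m (ways (m + m) k) t + box m (ways (m + m) k) (t ℤ.- ℤ.+ m)
    ≡⟨ cong₂ _+_ (half t) (trans (half (t ℤ.- ℤ.+ m))
         (Σ<-cong (suc k) (λ j → cong (λ s → (k C j) * ways m (suc k) s) (sym (minus-pos-+ t m (j * m)))))) ⟩
  Σ< (suc k) (λ j → (k C j) * g j) + Σ< (suc k) (λ j → (k C j) * g (suc j))
    ≡⟨ cong (_+ Σ< (suc k) (λ j → (k C j) * g (suc j))) (Σ<-C-drop-last k g) ⟨
  Σ< (suc (suc k)) (λ j → (k C j) * g j) + Σ< (suc k) (λ j → (k C j) * g (suc j))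
    ≡⟨ Σ<-pascal k (suc k) g ⟨
  Σ< (suc (suc k)) (λ j → (suc k C j) * g j) ∎
  where
  open ≡-Reasoning
  g : ℕ → ℕ
  g j = ways m (suc k) (t ℤ.- ℤ.+ (j * m))
  half : ∀ s → box m (ways (m + m) k) s ≡ Σ< (suc k) (λ j → (k C j) * ways m (suc k) (s ℤ.- ℤ.+ (j * m)))
  half s = trans (box-cong m (ways-double m k) s)
                 (box-Σ-shifts m (suc k) (k C_) (λ j → ℤ.+ (j * m)) (ways m k) s)

Σ<-ways-blocks-≤ : ∀ m k n t → Σ< n (λ j → ways m (suc k) (t ℤ.- ℤ.+ (j * m))) ≤ m ^ k
Σ<-ways-blocks-≤ m k n t = subst (_≤ m ^ k) (sym (box-blocks n m (ways m k) t)) (box-ways-≤ m k (n * m) t)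

ways-double-≤ : ∀ m k c → (∀ j → suc k C j ≤ c) → ∀ t → ways (m + m) (suc k) t ≤ c * m ^ k
ways-double-≤ m k c C≤c t = begin
  ways (m + m) (suc k) t
    ≡⟨ ways-double m (suc k) t ⟩
  Σ< (suc (suc k)) (λ j → (suc k C j) * ways m (suc k) (t ℤ.- ℤ.+ (j * m)))
    ≤⟨ Σ<-mono-≤ (suc (suc k)) (λ j → *-monoˡ-≤ (ways m (suc k) (t ℤ.- ℤ.+ (j * m))) (C≤c j)) ⟩
  Σ< (suc (suc k)) (λ j → c * ways m (suc k) (t ℤ.- ℤ.+ (j * m)))
    ≡⟨ Σ<-distribˡ-* (suc (suc k)) c (λ j → ways m (suc k) (t ℤ.- ℤ.+ (j * m))) ⟩
  c * Σ< (suc (suc k)) (λ j → ways m (suc k) (t ℤ.- ℤ.+ (j * m)))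
    ≤⟨ *-monoʳ-≤ c (Σ<-ways-blocks-≤ m k (suc (suc k)) t) ⟩
  c * m ^ k ∎
  where open ≤-Reasoning

correction-≤ : ∀ a b k N → a ≤ N → a * (k * b * N ^ (k ∸ 1)) + b * N ^ k ≤ suc k * b * N ^ k
correction-≤ a b zero    N a≤N = ≤-reflexive (identity a b)
  where
  identity : ∀ a b → a * (0 * b * 1) + b * 1 ≡ 1 * b * 1
  identity = solve-∀
correction-≤ a b (suc k) N a≤N = begin
  a * (suc k * b * N ^ k) + b * N ^ suc k   ≤⟨ +-monoˡ-≤ (b * N ^ suc k) (*-monoˡ-≤ (suc k * b * N ^ k) a≤N) ⟩
  N * (suc k * b * N ^ k) + b * (N * N ^ k) ≡⟨ collect N k b (N ^ k) ⟩
  suc (suc k) * b * N ^ suc k               ∎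
  where
  open ≤-Reasoning
  collect : ∀ N k b p → N * (suc k * b * p) + b * (N * p) ≡ suc (suc k) * b * (N * p)
  collect = solve-∀

box-ways-+-≤ : ∀ a b k R s → box R (ways (a + b) k) s ≤ box R (ways a k) s + k * b * (a + b) ^ (k ∸ 1)
box-ways-+-≤ a b zero    R s = m≤m+n _ _
box-ways-+-≤ a b (suc k) R s = begin
  box R (box N (ways N k)) s
    ≡⟨ box-comm R N (ways N k) s ⟩
  box N (box R (ways N k)) s
    ≡⟨ box-++ a b (box R (ways N k)) s ⟩
  box a (box R (ways N k)) s + box b (box R (ways N k)) (s ℤ.- ℤ.+ a)
    ≤⟨ +-mono-≤ (box-≤-+ a E (box-ways-+-≤ a b k R) s)
                (Σ<-≤-const b (N ^ k) (λ i → box-ways-≤ N k R (s ℤ.- ℤ.+ a ℤ.- ℤ.+ suc i))) ⟩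
  box a (box R (ways a k)) s + a * E + b * N ^ k
    ≡⟨ +-assoc (box a (box R (ways a k)) s) (a * E) (b * N ^ k) ⟩
  box a (box R (ways a k)) s + (a * E + b * N ^ k)
    ≤⟨ +-mono-≤ (≤-reflexive (box-comm a R (ways a k) s)) (correction-≤ a b k N (m≤m+n a b)) ⟩
  box R (ways a (suc k)) s + suc k * b * N ^ k ∎
  where
  open ≤-Reasoning
  N = a + b
  E = k * b * N ^ (k ∸ 1)

ways-+-≤ : ∀ a b k t → ways (a + b) (suc k) t ≤ ways a (suc k) t + suc k * b * (a + b) ^ (k ∸ 1)
ways-+-≤ a b k t = begin
  box (a + b) (ways (a + b) k) t
    ≡⟨ box-++ a b (ways (a + b) k) t ⟩
  box a (ways (a + b) k) t + box b (ways (a + b) k) (t ℤ.- ℤ.+ a)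
    ≤⟨ +-mono-≤ (box-ways-+-≤ a b k a t) (Σ<-≤-const b P (λ i → ways-≤ (a + b) k _)) ⟩
  ways a (suc k) t + k * b * P + b * P
    ≡⟨ collect (ways a (suc k) t) k b P ⟩
  ways a (suc k) t + suc k * b * P ∎
  where
  open ≤-Reasoning
  P = (a + b) ^ (k ∸ 1)
  collect : ∀ w k b P → w + k * b * P + b * P ≡ w + suc k * b * P
  collect = solve-∀

ways-halves-≤ : ∀ m r q c t → (∀ j → suc (suc q) C j ≤ c) →
  ways (m + m + r) (suc (suc q)) t ≤ c * m ^ suc q + suc (suc q) * r * (m + m + r) ^ q
ways-halves-≤ m r q c t C≤c =
  ≤-trans (ways-+-≤ (m + m) r (suc q) t) (+-monoˡ-≤ _ (ways-double-≤ m (suc q) c C≤c t))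

halves-arith : ∀ m r q c X → c * X ≤ 2 ^ suc (suc q) → suc (suc q) * X ≤ m + m + r → r ≤ 1 →
  X * ((c * m ^ suc q + suc (suc q) * r * (m + m + r) ^ q) * (m + m + r)) ≤ 3 * (m + m + r) ^ suc (suc q)
halves-arith m r q c X cX≤2^K KX≤N r≤1 = begin
  X * ((c * m ^ suc q + K * r * N ^ q) * N)
    ≡⟨ regroup X c (m ^ suc q) K r (N ^ q) N ⟩
  (c * X) * m ^ suc q * N + (K * X) * r * (N ^ q * N)
    ≤⟨ +-mono-≤ (*-monoˡ-≤ N (*-monoˡ-≤ (m ^ suc q) cX≤2^K)) (*-monoˡ-≤ (N ^ q * N) (*-mono-≤ KX≤N r≤1)) ⟩
  2 ^ K * m ^ suc q * N + N * 1 * (N ^ q * N)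
    ≡⟨ cong (λ p → p * N + N * 1 * (N ^ q * N))
            (trans (*-assoc 2 (2 ^ suc q) (m ^ suc q)) (cong (2 *_) (sym (^-distribʳ-* 2 m (suc q))))) ⟩
  2 * (2 * m) ^ suc q * N + N * 1 * (N ^ q * N)
    ≤⟨ +-monoˡ-≤ (N * 1 * (N ^ q * N)) (*-monoˡ-≤ N (*-monoʳ-≤ 2 (^-monoˡ-≤ (suc q) 2m≤N))) ⟩
  2 * N ^ suc q * N + N * 1 * (N ^ q * N)
    ≡⟨ collect N (N ^ q) ⟩
  3 * N ^ K ∎
  where
  open ≤-Reasoning
  K = suc (suc q)
  N = m + m + r
  2m≤N : 2 * m ≤ N
  2m≤N = ≤-trans (≤-reflexive (cong (m +_) (+-identityʳ m))) (m≤m+n (m + m) r)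
  regroup : ∀ X c M K r p N → X * ((c * M + K * r * p) * N) ≡ (c * X) * M * N + (K * X) * r * (p * N)
  regroup = solve-∀
  collect : ∀ N p → 2 * (N * p) * N + N * 1 * (p * N) ≡ 3 * (N * (N * p))
  collect = solve-∀

X*ways*N-≤ : ∀ q c X N t → (∀ j → suc (suc q) C j ≤ c) → c * X ≤ 2 ^ suc (suc q) → suc (suc q) * X ≤ N →
  X * (ways N (suc (suc q)) t * N) ≤ 3 * N ^ suc (suc q)
X*ways*N-≤ q c X N t C≤c cX≤2^K KX≤N =
  subst (λ N → X * (ways N (suc (suc q)) t * N) ≤ 3 * N ^ suc (suc q)) halves≡N
    (≤-trans (*-monoʳ-≤ X (*-monoˡ-≤ (m + m + r) (ways-halves-≤ m r q c t C≤c)))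
             (halves-arith m r q c X cX≤2^K (subst (suc (suc q) * X ≤_) (sym halves≡N) KX≤N) r≤1))
  where
  m = N / 2
  r = N % 2
  halves≡N : m + m + r ≡ N
  halves≡N = sym (trans (m≡m%n+[m/n]*n N 2) (rearrange r m))
    where
    rearrange : ∀ r m → r + m * 2 ≡ m + m + r
    rearrange = solve-∀
  r≤1 : r ≤ 1
  r≤1 = ≤-pred (m%n<n N 2)

sumCount-≤ : ∀ l X N t → X * X < l → 2 * l * X < N → X * (sumCount (2 * l) N t * N) ≤ 3 * N ^ (2 * l)
sumCount-≤ (suc l) X N t X²<L 2LX<N =
  subst (λ K → X * (sumCount K N t * N) ≤ 3 * N ^ K) (sym 2L≡K)
    (subst (λ w → X * (w * N) ≤ 3 * N ^ K) (sym (sumCount≡ways K N t))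
      (X*ways*N-≤ (l + l) c X N t C≤c cX≤2^K (subst (λ n → n * X ≤ N) 2L≡K (<⇒≤ 2LX<N))))
  where
  L = suc l
  K = suc (suc (l + l))
  c = (L + L) C L
  2L≡K : 2 * L ≡ K
  2L≡K = double-suc l
    where
    double-suc : ∀ l → 2 * suc l ≡ suc (suc (l + l))
    double-suc = solve-∀
  C≤c : ∀ j → K C j ≤ c
  C≤c j = subst (λ n → n C j ≤ c) (cong suc (+-suc l l)) (C-≤-central L j)
  cX≤2^K : c * X ≤ 2 ^ K
  cX≤2^K = subst (c * X ≤_) (trans (^-*-assoc 2 2 L) (cong (2 ^_) 2L≡K))
             (central-C-*-≤ L X (≤-trans (<⇒≤ X²<L) (≤-trans (m≤m+n L L) (n≤1+n (L + L)))))

-- Rational bounds for the exponential series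

toℚᵘ-ℕtoℚ : ∀ n → toℚᵘ (ℕtoℚ n) ℚᵘ.≃ mkℚᵘ (ℤ.+ n) 0
toℚᵘ-ℕtoℚ n = ℚ.toℚᵘ-fromℚᵘ (mkℚᵘ (ℤ.+ n) 0)

ℕtoℚ-+ : ∀ m n → ℕtoℚ (m + n) ≡ ℕtoℚ m ℚ.+ ℕtoℚ n
ℕtoℚ-+ m n = ℚ.toℚᵘ-injective (begin
  toℚᵘ (ℕtoℚ (m + n))                 ≈⟨ toℚᵘ-ℕtoℚ (m + n) ⟩
  mkℚᵘ (ℤ.+ (m + n)) 0                ≈⟨ *≡* (cong (ℤ._* ℤ.+ 1) (trans (ℤ.pos-+ m n) (sym (cong₂ ℤ._+_
                                           (ℤ.*-identityʳ (ℤ.+ m)) (ℤ.*-identityʳ (ℤ.+ n)))))) ⟩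
  mkℚᵘ (ℤ.+ m) 0 ℚᵘ.+ mkℚᵘ (ℤ.+ n) 0  ≈⟨ ℚᵘ.+-cong (toℚᵘ-ℕtoℚ m) (toℚᵘ-ℕtoℚ n) ⟨
  toℚᵘ (ℕtoℚ m) ℚᵘ.+ toℚᵘ (ℕtoℚ n)    ≈⟨ ℚ.toℚᵘ-homo-+ (ℕtoℚ m) (ℕtoℚ n) ⟨
  toℚᵘ (ℕtoℚ m ℚ.+ ℕtoℚ n)            ∎)
  where open ℚᵘ.≃-Reasoning

ℕtoℚ-* : ∀ m n → ℕtoℚ (m * n) ≡ ℕtoℚ m ℚ.* ℕtoℚ n
ℕtoℚ-* m n = ℚ.toℚᵘ-injective (begin
  toℚᵘ (ℕtoℚ (m * n))                 ≈⟨ toℚᵘ-ℕtoℚ (m * n) ⟩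
  mkℚᵘ (ℤ.+ (m * n)) 0                ≈⟨ *≡* (cong (ℤ._* ℤ.+ 1) (ℤ.pos-* m n)) ⟩
  mkℚᵘ (ℤ.+ m) 0 ℚᵘ.* mkℚᵘ (ℤ.+ n) 0  ≈⟨ ℚᵘ.*-cong (toℚᵘ-ℕtoℚ m) (toℚᵘ-ℕtoℚ n) ⟨
  toℚᵘ (ℕtoℚ m) ℚᵘ.* toℚᵘ (ℕtoℚ n)    ≈⟨ ℚ.toℚᵘ-homo-* (ℕtoℚ m) (ℕtoℚ n) ⟨
  toℚᵘ (ℕtoℚ m ℚ.* ℕtoℚ n)            ∎)
  where open ℚᵘ.≃-Reasoning

ℕtoℚ-mono-≤ : ∀ {m n} → m ≤ n → ℕtoℚ m ℚ.≤ ℕtoℚ n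
ℕtoℚ-mono-≤ {m} {n} m≤n = ℚ.toℚᵘ-cancel-≤ (begin
  toℚᵘ (ℕtoℚ m)   ≃⟨ toℚᵘ-ℕtoℚ m ⟩
  mkℚᵘ (ℤ.+ m) 0  ≤⟨ *≤* (ℤ.*-monoʳ-≤-nonNeg (ℤ.+ 1) (ℤ.+≤+ m≤n)) ⟩
  mkℚᵘ (ℤ.+ n) 0  ≃⟨ toℚᵘ-ℕtoℚ n ⟨
  toℚᵘ (ℕtoℚ n)   ∎)
  where open ℚᵘ.≤-Reasoning

ℕtoℚ-nonNeg : ∀ n → NonNegative (ℕtoℚ n)
ℕtoℚ-nonNeg n = ℚ.normalize-nonNeg n 1

ℕtoℚ-pos : ∀ n .{{_ : ℕ.NonZero n}} → Positive (ℕtoℚ n)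
ℕtoℚ-pos n = ℚ.normalize-pos n 1

ℕtoℚ-suc-*-1/suc : ∀ k → ℕtoℚ (suc k) ℚ.* (ℤ.+ 1 ℚ./ suc k) ≡ 1ℚ
ℕtoℚ-suc-*-1/suc k = ℚ.toℚᵘ-injective (begin
  toℚᵘ (ℕtoℚ (suc k) ℚ.* (ℤ.+ 1 ℚ./ suc k))         ≈⟨ ℚ.toℚᵘ-homo-* (ℕtoℚ (suc k)) _ ⟩
  toℚᵘ (ℕtoℚ (suc k)) ℚᵘ.* toℚᵘ (ℤ.+ 1 ℚ./ suc k)   ≈⟨ ℚᵘ.*-cong (toℚᵘ-ℕtoℚ (suc k)) (ℚ.toℚᵘ-fromℚᵘ (mkℚᵘ (ℤ.+ 1) k)) ⟩
  mkℚᵘ (ℤ.+ suc k) 0 ℚᵘ.* mkℚᵘ (ℤ.+ 1) k             ≈⟨ *≡* (units (ℤ.+ suc k)) ⟩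
  toℚᵘ 1ℚ                                             ∎)
  where
  open ℚᵘ.≃-Reasoning
  units : ∀ x → x ℤ.* ℤ.+ 1 ℤ.* ℤ.+ 1 ≡ ℤ.+ 1 ℤ.* (ℤ.+ 1 ℤ.* x)
  units = ℤ-Solver.solve-∀

archimedean : ∀ p → ∃[ n ] p ℚ.≤ ℕtoℚ n
archimedean (ℚ.mkℚ (ℤ.+ a) d _) = a , ℚ.toℚᵘ-cancel-≤ (ℚᵘ.≤-respʳ-≃ (ℚᵘ.≃-sym (toℚᵘ-ℕtoℚ a))
  (*≤* (ℤ.*-monoˡ-≤-nonNeg (ℤ.+ a) (ℤ.+≤+ (s≤s z≤n)))))
archimedean (ℚ.mkℚ -[1+ n ] d _) = 0 , ℚ.toℚᵘ-cancel-≤ (ℚᵘ.≤-respʳ-≃ (ℚᵘ.≃-sym (toℚᵘ-ℕtoℚ 0))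
  (*≤* ℤ.-≤+))

*-mono-≤-nonNeg : ∀ {p s} q r .{{_ : NonNegative q}} .{{_ : NonNegative r}} → p ℚ.≤ q → r ℚ.≤ s → p ℚ.* r ℚ.≤ q ℚ.* s
*-mono-≤-nonNeg q r p≤q r≤s = ℚ.≤-trans (ℚ.*-monoʳ-≤-nonNeg r p≤q) (ℚ.*-monoˡ-≤-nonNeg q r≤s)

1/suc-nonNeg : ∀ k → NonNegative (ℤ.+ 1 ℚ./ suc k)
1/suc-nonNeg k = ℚ.normalize-nonNeg 1 (suc k)

*-1/suc-≤-1 : ∀ {p} k → p ℚ.≤ ℕtoℚ (suc k) → p ℚ.* (ℤ.+ 1 ℚ./ suc k) ℚ.≤ 1ℚ
*-1/suc-≤-1 k p≤k+1 = ℚ.≤-trans (ℚ.*-monoʳ-≤-nonNeg _ {{1/suc-nonNeg k}} p≤k+1) (ℚ.≤-reflexive (ℕtoℚ-suc-*-1/suc k))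

1/suc-≤-1 : ∀ k → ℤ.+ 1 ℚ./ suc k ℚ.≤ 1ℚ
1/suc-≤-1 k = ℚ.≤-trans (ℚ.≤-reflexive (sym (ℚ.*-identityˡ _))) (*-1/suc-≤-1 k (ℕtoℚ-mono-≤ {1} {suc k} (s≤s z≤n)))

module _ (y : ℚ) .{{y≥0 : NonNegative y}} where

  expTerm-nonNeg : ∀ k → NonNegative (expTerm y k)
  expTerm-nonNeg zero    = _
  expTerm-nonNeg (suc k) =
    ℚ.nonNeg*nonNeg⇒nonNeg (expTerm y k ℚ.* y) {{ℚ.nonNeg*nonNeg⇒nonNeg (expTerm y k) {{expTerm-nonNeg k}} y}}
                           (ℤ.+ 1 ℚ./ suc k) {{1/suc-nonNeg k}}

  expTerm-≤-^ : ∀ M → y ℚ.≤ ℕtoℚ M → ∀ k → expTerm y k ℚ.≤ ℕtoℚ (M ^ k)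
  expTerm-≤-^ M y≤M zero    = ℚ.≤-refl
  expTerm-≤-^ M y≤M (suc k) = begin
    expTerm y k ℚ.* y ℚ.* (ℤ.+ 1 ℚ./ suc k)
      ≤⟨ *-mono-≤-nonNeg (ℕtoℚ (M ^ k) ℚ.* ℕtoℚ M) (ℤ.+ 1 ℚ./ suc k)
           {{ℚ.nonNeg*nonNeg⇒nonNeg (ℕtoℚ (M ^ k)) {{ℕtoℚ-nonNeg (M ^ k)}} (ℕtoℚ M) {{ℕtoℚ-nonNeg M}}}} {{1/suc-nonNeg k}}
           (*-mono-≤-nonNeg (ℕtoℚ (M ^ k)) y {{ℕtoℚ-nonNeg (M ^ k)}} (expTerm-≤-^ M y≤M k) y≤M)
           (1/suc-≤-1 k) ⟩
    ℕtoℚ (M ^ k) ℚ.* ℕtoℚ M ℚ.* 1ℚ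
      ≡⟨ ℚ.*-identityʳ _ ⟩
    ℕtoℚ (M ^ k) ℚ.* ℕtoℚ M
      ≡⟨ trans (cong ℕtoℚ (*-comm M (M ^ k))) (ℕtoℚ-* (M ^ k) M) ⟨
    ℕtoℚ (M ^ suc k) ∎
    where open ℚ.≤-Reasoning

  expTerm-halves : ∀ k → ℕtoℚ 2 ℚ.* y ℚ.≤ ℕtoℚ (suc k) →
    expTerm y (suc k) ℚ.* ℕtoℚ (2 ^ suc k) ℚ.≤ expTerm y k ℚ.* ℕtoℚ (2 ^ k)
  expTerm-halves k 2y≤k+1 = begin
    T ℚ.* y ℚ.* 1/k+1 ℚ.* ℕtoℚ (2 * 2 ^ k)   ≡⟨ cong (T ℚ.* y ℚ.* 1/k+1 ℚ.*_) (ℕtoℚ-* 2 (2 ^ k)) ⟩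
    T ℚ.* y ℚ.* 1/k+1 ℚ.* (two ℚ.* P)         ≡⟨ regroup T y 1/k+1 two P ⟩
    (T ℚ.* P) ℚ.* (two ℚ.* y ℚ.* 1/k+1)       ≤⟨ ℚ.*-monoˡ-≤-nonNeg (T ℚ.* P) {{TP≥0}} (*-1/suc-≤-1 k 2y≤k+1) ⟩
    (T ℚ.* P) ℚ.* 1ℚ                          ≡⟨ ℚ.*-identityʳ (T ℚ.* P) ⟩
    T ℚ.* P                                   ∎
    where
    open ℚ.≤-Reasoning
    T = expTerm y k
    P = ℕtoℚ (2 ^ k)
    two = ℕtoℚ 2
    1/k+1 = ℤ.+ 1 ℚ./ suc k
    TP≥0 : NonNegative (T ℚ.* P)
    TP≥0 = ℚ.nonNeg*nonNeg⇒nonNeg T {{expTerm-nonNeg k}} P {{ℕtoℚ-nonNeg (2 ^ k)}}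
    regroup : ∀ t y i w p → t ℚ.* y ℚ.* i ℚ.* (w ℚ.* p) ≡ (t ℚ.* p) ℚ.* (w ℚ.* y ℚ.* i)
    regroup = ℚ-Solver.solve 5 (λ t y i w p → t :* y :* i :* (w :* p) := (t :* p) :* (w :* y :* i)) refl
      where open ℚ-Solver using (_:*_; _:=_)

  expTerm-*2^-≤ : ∀ M → y ℚ.≤ ℕtoℚ (suc M) → ∀ k →
    expTerm y k ℚ.* ℕtoℚ (2 ^ k) ℚ.≤ ℕtoℚ ((2 * suc M) ^ (2 * suc M))
  expTerm-*2^-≤ M y≤M k with k ≤? 2 * suc M
  ... | yes k≤2M = begin
    expTerm y k ℚ.* ℕtoℚ (2 ^ k)       ≤⟨ ℚ.*-monoʳ-≤-nonNeg (ℕtoℚ (2 ^ k)) {{ℕtoℚ-nonNeg (2 ^ k)}} (expTerm-≤-^ (suc M) y≤M k) ⟩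
    ℕtoℚ (suc M ^ k) ℚ.* ℕtoℚ (2 ^ k)  ≡⟨ ℕtoℚ-* (suc M ^ k) (2 ^ k) ⟨
    ℕtoℚ (suc M ^ k * 2 ^ k)           ≡⟨ cong ℕtoℚ (trans (sym (^-distribʳ-* (suc M) 2 k)) (cong (_^ k) (*-comm (suc M) 2))) ⟩
    ℕtoℚ ((2 * suc M) ^ k)             ≤⟨ ℕtoℚ-mono-≤ (^-monoʳ-≤ (2 * suc M) k≤2M) ⟩
    ℕtoℚ ((2 * suc M) ^ (2 * suc M))   ∎
    where open ℚ.≤-Reasoning
  expTerm-*2^-≤ M y≤M zero    | no 0≰2M   = contradiction z≤n 0≰2M
  expTerm-*2^-≤ M y≤M (suc k) | no k+1≰2M =
    ℚ.≤-trans (expTerm-halves k 2y≤k+1) (expTerm-*2^-≤ M y≤M k)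
    where
    2y≤k+1 : ℕtoℚ 2 ℚ.* y ℚ.≤ ℕtoℚ (suc k)
    2y≤k+1 = begin
      ℕtoℚ 2 ℚ.* y             ≤⟨ ℚ.*-monoˡ-≤-nonNeg (ℕtoℚ 2) {{ℕtoℚ-nonNeg 2}} y≤M ⟩
      ℕtoℚ 2 ℚ.* ℕtoℚ (suc M)  ≡⟨ ℕtoℚ-* 2 (suc M) ⟨
      ℕtoℚ (2 * suc M)         ≤⟨ ℕtoℚ-mono-≤ (<⇒≤ (≰⇒> k+1≰2M)) ⟩
      ℕtoℚ (suc k)             ∎
      where open ℚ.≤-Reasoning

expPartial-*2^-+-≤ : ∀ y B → (∀ k → expTerm y k ℚ.* ℕtoℚ (2 ^ k) ℚ.≤ ℕtoℚ B) → ∀ n →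
  expPartial y n ℚ.* ℕtoℚ (2 ^ n) ℚ.+ ℕtoℚ B ℚ.≤ (ℕtoℚ B ℚ.+ ℕtoℚ B) ℚ.* ℕtoℚ (2 ^ n)
expPartial-*2^-+-≤ y B dominated zero    = begin
  1ℚ ℚ.* 1ℚ ℚ.+ b     ≤⟨ ℚ.+-monoˡ-≤ b (dominated 0) ⟩
  b ℚ.+ b             ≡⟨ ℚ.*-identityʳ (b ℚ.+ b) ⟨
  (b ℚ.+ b) ℚ.* 1ℚ    ∎
  where
  open ℚ.≤-Reasoning
  b = ℕtoℚ B
expPartial-*2^-+-≤ y B dominated (suc n) = begin
  (S ℚ.+ T) ℚ.* ℕtoℚ (2 * 2 ^ n) ℚ.+ b
    ≡⟨ cong (λ z → (S ℚ.+ T) ℚ.* z ℚ.+ b) (ℕtoℚ-* 2 (2 ^ n)) ⟩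
  (S ℚ.+ T) ℚ.* (two ℚ.* P) ℚ.+ b
    ≡⟨ split S T two P b ⟩
  (S ℚ.* P) ℚ.* two ℚ.+ (T ℚ.* (two ℚ.* P) ℚ.+ b)
    ≤⟨ ℚ.+-monoʳ-≤ ((S ℚ.* P) ℚ.* two) (ℚ.+-monoˡ-≤ b T·2P≤b) ⟩
  (S ℚ.* P) ℚ.* two ℚ.+ (b ℚ.+ b)
    ≡⟨ factor (S ℚ.* P) b ⟩
  (S ℚ.* P ℚ.+ b) ℚ.* two
    ≤⟨ ℚ.*-monoʳ-≤-nonNeg two {{ℕtoℚ-nonNeg 2}} (expPartial-*2^-+-≤ y B dominated n) ⟩
  (b ℚ.+ b) ℚ.* P ℚ.* two
    ≡⟨ ℚ.*-assoc (b ℚ.+ b) P two ⟩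
  (b ℚ.+ b) ℚ.* (P ℚ.* two)
    ≡⟨ cong ((b ℚ.+ b) ℚ.*_) (trans (ℚ.*-comm P two) (sym (ℕtoℚ-* 2 (2 ^ n)))) ⟩
  (b ℚ.+ b) ℚ.* ℕtoℚ (2 * 2 ^ n) ∎
  where
  open ℚ.≤-Reasoning
  b = ℕtoℚ B
  two = ℕtoℚ 2
  S = expPartial y n
  T = expTerm y (suc n)
  P = ℕtoℚ (2 ^ n)
  T·2P≤b : T ℚ.* (two ℚ.* P) ℚ.≤ b
  T·2P≤b = subst (λ z → T ℚ.* z ℚ.≤ b) (ℕtoℚ-* 2 (2 ^ n)) (dominated (suc n))
  open ℚ-Solver using (_:+_; _:*_; _:=_; con)
  split : ∀ s t w p b → (s ℚ.+ t) ℚ.* (w ℚ.* p) ℚ.+ b ≡ (s ℚ.* p) ℚ.* w ℚ.+ (t ℚ.* (w ℚ.* p) ℚ.+ b)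
  split = ℚ-Solver.solve 5 (λ s t w p b → (s :+ t) :* (w :* p) :+ b := (s :* p) :* w :+ (t :* (w :* p) :+ b)) refl
  -- ℕtoℚ 2 and 1ℚ ℚ.+ 1ℚ have the same normal form, so the solver may read two as 1 + 1.
  factor : ∀ a b → a ℚ.* two ℚ.+ (b ℚ.+ b) ≡ (a ℚ.+ b) ℚ.* two
  factor = ℚ-Solver.solve 2 (λ a b → a :* (con 1ℚ :+ con 1ℚ) :+ (b :+ b) := (a :+ b) :* (con 1ℚ :+ con 1ℚ)) refl

expPartial-≤ : ∀ y B → (∀ k → expTerm y k ℚ.* ℕtoℚ (2 ^ k) ℚ.≤ ℕtoℚ B) → ∀ n → expPartial y n ℚ.≤ ℕtoℚ (B + B)
expPartial-≤ y B dominated n = ℚ.*-cancelʳ-≤-pos (ℕtoℚ (2 ^ n)) {{ℕtoℚ-pos (2 ^ n) {{m^n≢0 2 n}}}} (begin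
  S·P                               ≡⟨ ℚ.+-identityʳ S·P ⟨
  S·P ℚ.+ 0ℚ                        ≤⟨ ℚ.+-monoʳ-≤ S·P (ℚ.nonNegative⁻¹ (ℕtoℚ B) {{ℕtoℚ-nonNeg B}}) ⟩
  S·P ℚ.+ ℕtoℚ B                    ≤⟨ expPartial-*2^-+-≤ y B dominated n ⟩
  (ℕtoℚ B ℚ.+ ℕtoℚ B) ℚ.* ℕtoℚ (2 ^ n)  ≡⟨ cong (ℚ._* ℕtoℚ (2 ^ n)) (ℕtoℚ-+ B B) ⟨
  ℕtoℚ (B + B) ℚ.* ℕtoℚ (2 ^ n)     ∎)
  where
  open ℚ.≤-Reasoning
  S·P = expPartial y n ℚ.* ℕtoℚ (2 ^ n)

expPartial-bounded : ∀ y .{{_ : NonNegative y}} → ∃[ B ] (∀ n → expPartial y n ℚ.≤ ℕtoℚ B)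
expPartial-bounded y with archimedean y
... | M , y≤M = D + D , expPartial-≤ y D (expTerm-*2^-≤ y M (ℚ.≤-trans y≤M (ℕtoℚ-mono-≤ (n≤1+n M))))
  where D = (2 * suc M) ^ (2 * suc M)

lemma8 : (C : ℚ) → 0ℚ ℚ.< C →
    ∃[ ℓ₀ ] ((ℓ : ℕ) → ℓ₀ < ℓ →
      ∃[ N₀ ] ((N : ℕ) → N₀ < N → (t : ℤ) →
        ExpMulLe (ℕtoℚ 4 ℚ.* C) (ℕtoℚ (sumCount (2 * ℓ) N t * N)) (ℕtoℚ (5 * N ^ (2 * ℓ)))))
lemma8 C 0<C =
  B * B , λ ℓ B²<ℓ → 2 * ℓ * B , λ N 2ℓB<N t n →
    scale n (sumCount (2 * ℓ) N t * N) (N ^ (2 * ℓ)) (sumCount-≤ ℓ B N t B²<ℓ 2ℓB<N)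
  where
  y = ℕtoℚ 4 ℚ.* C
  -- (C) is parenthesised because the binomial operator _C_ is in scope.
  instance
    y≥0 : NonNegative y
    y≥0 = ℚ.nonNeg*nonNeg⇒nonNeg (ℕtoℚ 4) {{ℕtoℚ-nonNeg 4}} (C) {{ℚ.pos⇒nonNeg (C) {{ℚ.positive 0<C}}}}
  B = proj₁ (expPartial-bounded y)
  scale : ∀ n c m → B * c ≤ 3 * m → expPartial y n ℚ.* ℕtoℚ c ℚ.≤ ℕtoℚ (5 * m)
  scale n c m Bc≤3m = begin
    expPartial y n ℚ.* ℕtoℚ c  ≤⟨ ℚ.*-monoʳ-≤-nonNeg (ℕtoℚ c) {{ℕtoℚ-nonNeg c}} (proj₂ (expPartial-bounded y) n) ⟩
    ℕtoℚ B ℚ.* ℕtoℚ c          ≡⟨ ℕtoℚ-* B c ⟨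
    ℕtoℚ (B * c)               ≤⟨ ℕtoℚ-mono-≤ (≤-trans Bc≤3m (*-monoˡ-≤ m {3} {5} (s≤s (s≤s (s≤s z≤n))))) ⟩
    ℕtoℚ (5 * m)               ∎
    where open ℚ.≤-Reasoning
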